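{- Let $\mathfrak{v}$ be a language valuation over a set $X$ and $w$ a word over $X$. For every variable $x$ and term $t$, if $w \in \hat{\mathfrak{v}}(x) \setminus \hat{\mathfrak{v}}(t)$ then $\ell \in \hat{\mathfrak{v}}^{w}(x) \setminus \hat{\mathfrak{v}}^{w}(t)$.
   Context: Let $\mathbf{V}$ be a set of variables. Terms are generated by $t, s ::= x \mid \mathrm{I} \mid \bot \mid t \cdot s \mid t \cup s \mid t^{*} \mid x^{ - }$ ($x \in \mathbf{V}$). For a set $X$, a language valuation over $X$ is a map $\mathfrak{v}$ from variables to subsets of $X^{*}$ ($\mathrm{I}$ = empty word), extended to terms $\hat{\mathfrak{v}}$ by $\hat{\mathfrak{v}}(\mathrm{I}) = \{\mathrm{I}\}$, $\hat{\mathfrak{v}}(\bot) = \emptyset$, $\hat{\mathfrak{v}}(t\cdot s) = \{ab \mid a \in \hat{\mathfrak{v}}(t), b \in \hat{\mathfrak{v}}(s)\}$, $\hat{\mathfrak{v}}(t \cup s) = \hat{\mathfrak{v}}(t)\cup\hat{\mathfrak{v}}(s)$, $\hat{\mathfrak{v}}(t^{*}) = \hat{\mathfrak{v}}(t)^{*}$, $\hat{\mathfrak{v}}(x^{ - }) = X^{*} \setminus \mathfrak{v}(x)$. For a language valuation $\mathfrak{v}$ over $X$ and a word $w$ over $X$, $\mathfrak{v}^{w}$ is the language valuation over the one-letter set $\{\ell\}$ given by $\mathfrak{v}^{w}(x) = \{\mathrm{I} \mid \mathrm{I} \in \mathfrak{v}(x)\} \cup \{\ell \mid w \in \mathfrak{v}(x)\}$.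 -}

module Defs where

open import Data.List using (List; []; _∷_; _++_)
open import Data.Product using (Σ; _×_; _,_)
open import Data.Sum using (_⊎_)
open import Data.Unit using (⊤; tt)
open import Relation.Nullary using (¬_)
open import Relation.Binary.PropositionalEquality using (_≡_)

data Term (V : Set) : Set where
  var  : V → Term V
  I    : Term V
  bot  : Term V
  _·_  : Term V → Term V → Term V
  _∪_  : Term V → Term V → Term V
  _*   : Term V → Term V
  _⁻   : V → Term V

Lang : Set → Set₁
Lang X = List X → Set

concatL : {X : Set} → Lang X → Lang X → Lang X
concatL L M u = Σ (List _) λ a → Σ (List _) λ b → (u ≡ a ++ b) × (L a × M b)

data Star {X : Set} (L : Lang X) : Lang X where
  star-nil  : Star L []
  star-cons : ∀ {a u} → L a → Star L u → Star L (a ++ u)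

Valuation : Set → Set → Set₁
Valuation V X = V → Lang X

⟦_⟧ : {V X : Set} → Term V → Valuation V X → Lang X
⟦ var x ⟧ v u = v x u
⟦ I ⟧ v u = u ≡ []
⟦ bot ⟧ v u = Data.Empty.⊥
  where import Data.Empty
⟦ t · s ⟧ v = concatL (⟦ t ⟧ v) (⟦ s ⟧ v)
⟦ t ∪ s ⟧ v u = ⟦ t ⟧ v u ⊎ ⟦ s ⟧ v u
⟦ t * ⟧ v = Star (⟦ t ⟧ v)
⟦ x ⁻ ⟧ v u = ¬ v x u

Letter : Set
Letter = ⊤

ℓ : List Letter
ℓ = tt ∷ []

_^_ : {V X : Set} → Valuation V X → List X → Valuation V Letter
(v ^ w) x u = ((u ≡ []) × v x []) ⊎ ((u ≡ ℓ) × v x w)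

{-# OPTIONS --safe #-}
module Submission where

open import Defs
open import Data.List using (List; []; _∷_; _++_)
open import Data.List.Properties using (++-identityʳ)
open import Data.Product using (_×_; _,_)
open import Data.Sum using (_⊎_; inj₁; inj₂)
open import Relation.Nullary using (¬_)
open import Relation.Binary.PropositionalEquality using (_≡_; refl; sym; subst)

-- Idea: by induction on t, membership of [] and of ℓ in ⟦ t ⟧ (v ^ w) is
-- reflected to membership of [] and of w in ⟦ t ⟧ v.  A factorisation of ℓ
-- has one factor empty, so it lifts to the factorisation w = [] ++ w or
-- w = w ++ []; complements occur only on variables, where v ^ w agrees with v
-- on both words by construction.

concatL-[] : {X : Set} {L M : Lang X} → concatL L M [] → L [] × M []
concatL-[] ([] , [] , refl , p , q) = p , q

concatL-ℓ : {L M : Lang Letter} → concatL L M ℓ → (L [] × M ℓ) ⊎ (L ℓ × M [])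
concatL-ℓ ([] , _ , refl , p , q)    = inj₁ (p , q)
concatL-ℓ (_ ∷ [] , [] , refl , p , q) = inj₂ (p , q)

Star-singleton : {X : Set} {L : Lang X} {u : List X} → L u → Star L u
Star-singleton {u = u} p = subst (Star _) (++-identityʳ u) (star-cons p star-nil)

Star-ℓ : {L : Lang Letter} {u : List Letter} → Star L u → u ≡ ℓ → L ℓ
Star-ℓ star-nil ()
Star-ℓ (star-cons {a = []} _ s) e = Star-ℓ s e
Star-ℓ (star-cons {a = _ ∷ []} p _) refl = p
Star-ℓ (star-cons {a = _ ∷ _ ∷ _} _ _) ()

module _ {V X : Set} (v : Valuation V X) (w : List X) where

  ^-reflects-[] : (t : Term V) → ⟦ t ⟧ (v ^ w) [] → ⟦ t ⟧ v []
  ^-reflects-[] (var x) (inj₁ (_ , p)) = p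
  ^-reflects-[] I       _              = refl
  ^-reflects-[] (t · s) p with concatL-[] p
  ... | p₁ , p₂ = [] , [] , refl , ^-reflects-[] t p₁ , ^-reflects-[] s p₂
  ^-reflects-[] (t ∪ s) (inj₁ p)       = inj₁ (^-reflects-[] t p)
  ^-reflects-[] (t ∪ s) (inj₂ p)       = inj₂ (^-reflects-[] s p)
  ^-reflects-[] (t *)   _              = star-nil
  ^-reflects-[] (x ⁻)   ¬p p           = ¬p (inj₁ (refl , p))

  ^-reflects-ℓ : (t : Term V) → ⟦ t ⟧ (v ^ w) ℓ → ⟦ t ⟧ v w
  ^-reflects-ℓ (var x) (inj₂ (_ , p)) = p
  ^-reflects-ℓ (t · s) p with concatL-ℓ p
  ... | inj₁ (p₁ , p₂) = [] , w , refl , ^-reflects-[] t p₁ , ^-reflects-ℓ s p₂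
  ... | inj₂ (p₁ , p₂) = w , [] , sym (++-identityʳ w) , ^-reflects-ℓ t p₁ , ^-reflects-[] s p₂
  ^-reflects-ℓ (t ∪ s) (inj₁ p)       = inj₁ (^-reflects-ℓ t p)
  ^-reflects-ℓ (t ∪ s) (inj₂ p)       = inj₂ (^-reflects-ℓ s p)
  ^-reflects-ℓ (t *)   p              = Star-singleton (^-reflects-ℓ t (Star-ℓ p refl))
  ^-reflects-ℓ (x ⁻)   ¬p p           = ¬p (inj₂ (refl , p))

corollary4p4 : {V X : Set} (v : Valuation V X) (w : List X) (x : V) (t : Term V) →
    ⟦ var x ⟧ v w × ¬ ⟦ t ⟧ v w →
    ⟦ var x ⟧ (v ^ w) ℓ × ¬ ⟦ t ⟧ (v ^ w) ℓ
corollary4p4 v w x t (w∈x , w∉t) = inj₂ (refl , w∈x) , λ ℓ∈t → w∉t (^-reflects-ℓ v w t ℓ∈t)
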